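{- Consider any depth-first exploration of a finite directed graph. A vertex $v$ is the leader of its strong component $C$ if and only if there is no directed path, all of whose vertices lie in $C$, that starts at $v$, consists of zero or more tree arcs followed by exactly one non-tree arc, and ends at a vertex $w$ with $w.\mathit{pre}<v.\mathit{pre}$.
   Context: Loops and parallel arcs are allowed. Two vertices are mutually reachable if each is reachable from the other; the equivalence classes are the strong components. A depth-first exploration proceeds as follows. Initially all vertices are unvisited, all arcs untraversed, and the current vertex is null. Repeat the applicable case until all vertices are visited and all arcs are traversed: (i) The current vertex is null and some vertex is unvisited: choose any unvisited $v$, make it current and visit it; $v$ is a root. (ii) The current vertex $v$ has an untraversed exiting arc: choose any such arc $a$, from $v$ to $w$, and advance on it. If $w$ is visited, immediately retreat on $a$ ($a$ is then a non-tree arc). Otherwise $a$ becomes a tree arc, $w$ becomes current and is visited. (iii) The current vertex $v$ has no untraversed exiting arc: if $v$ is a root, the current vertex becomes null; otherwise retreat on the tree arc entering $v$, from $u$ say, and make $u$ current. The first visit of $v$ is its previsit, at time $v.\mathit{pre}$; times are ordered as the visits occur. The leader of a strong component is its vertex with minimum $\mathit{pre}$ value. -}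

module Defs where

open import Data.Nat using (ℕ; zero; suc; _<_; _≤_)
open import Data.Fin using (Fin; _≟_)
open import Data.List using (List; []; _∷_; _∷ʳ_)
open import Data.List.Membership.Propositional using (_∈_; _∉_)
open import Data.Maybe using (Maybe; just; nothing)
open import Data.Product using (Σ; _×_; _,_; ∃)
open import Relation.Nullary using (¬_; yes; no)
open import Relation.Binary.PropositionalEquality using (_≡_)
open import Relation.Binary.Construct.Closure.ReflexiveTransitive using (Star)

record Graph : Set where
  field
    n   : ℕ
    m   : ℕ
    src : Fin m → Fin n
    tgt : Fin m → Fin n
open Graph public

Arc : (G : Graph) → Fin (n G) → Fin (n G) → Set
Arc G u w = ∃ λ (a : Fin (m G)) → src G a ≡ u × tgt G a ≡ w

Reachable : (G : Graph) → Fin (n G) → Fin (n G) → Set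
Reachable G = Star (Arc G)

MutuallyReachable : (G : Graph) → Fin (n G) → Fin (n G) → Set
MutuallyReachable G u w = Reachable G u w × Reachable G w u

record DFSState (G : Graph) : Set where
  constructor mkState
  field
    visitOrder : List (Fin (n G))   -- visited vertices, in order of previsit
    traversed  : List (Fin (m G))
    treeArcs   : List (Fin (m G))
    roots      : List (Fin (n G))
    current    : Maybe (Fin (n G))  -- current vertex (nothing = null)
open DFSState public

initial : (G : Graph) → DFSState G
initial G = mkState [] [] [] [] nothing

data Step (G : Graph) : DFSState G → DFSState G → Set where
  newRoot : ∀ {vo tr ta rs} (v : Fin (n G)) → v ∉ vo →
    Step G (mkState vo tr ta rs nothing) (mkState (vo ∷ʳ v) tr ta (rs ∷ʳ v) (just v))
  nonTreeArc : ∀ {vo tr ta rs v} (a : Fin (m G)) → src G a ≡ v → a ∉ tr → tgt G a ∈ vo →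
    Step G (mkState vo tr ta rs (just v)) (mkState vo (tr ∷ʳ a) ta rs (just v))
  treeArc : ∀ {vo tr ta rs v} (a : Fin (m G)) → src G a ≡ v → a ∉ tr → tgt G a ∉ vo →
    Step G (mkState vo tr ta rs (just v))
           (mkState (vo ∷ʳ tgt G a) (tr ∷ʳ a) (ta ∷ʳ a) rs (just (tgt G a)))
  finishRoot : ∀ {vo tr ta rs v} → (∀ a → src G a ≡ v → a ∈ tr) → v ∈ rs →
    Step G (mkState vo tr ta rs (just v)) (mkState vo tr ta rs nothing)
  retreat : ∀ {vo tr ta rs v} (a : Fin (m G)) → (∀ b → src G b ≡ v → b ∈ tr) → v ∉ rs →
    a ∈ ta → tgt G a ≡ v →
    Step G (mkState vo tr ta rs (just v)) (mkState vo tr ta rs (just (src G a)))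

Finished : (G : Graph) → DFSState G → Set
Finished G s = (∀ (v : Fin (n G)) → v ∈ visitOrder s) × (∀ (a : Fin (m G)) → a ∈ traversed s)

DepthFirstExploration : (G : Graph) → DFSState G → Set
DepthFirstExploration G s = Star (Step G) (initial G) s × Finished G s

position : ∀ {k} → List (Fin k) → Fin k → ℕ
position [] v = zero
position (x ∷ xs) v with x ≟ v
... | yes _ = zero
... | no _  = suc (position xs v)

-- v.pre: the time of the previsit of v, i.e. its index in the visit order.
pre : {G : Graph} → DFSState G → Fin (n G) → ℕ
pre s v = position (visitOrder s) v

IsTreeArc : {G : Graph} → DFSState G → Fin (m G) → Set
IsTreeArc s a = a ∈ treeArcs s

IsNonTreeArc : {G : Graph} → DFSState G → Fin (m G) → Set
IsNonTreeArc s a = a ∈ traversed s × a ∉ treeArcs s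

IsLeader : (G : Graph) → DFSState G → Fin (n G) → Set
IsLeader G s v = ∀ w → MutuallyReachable G v w → pre s v ≤ pre s w

data TreePath (G : Graph) (s : DFSState G) (S : Fin (n G) → Set) :
     Fin (n G) → Fin (n G) → Set where
  empty : ∀ {u} → S u → TreePath G s S u u
  cons  : ∀ {u x} (a : Fin (m G)) → IsTreeArc s a → src G a ≡ u → S u →
          TreePath G s S (tgt G a) x → TreePath G s S u x

EscapingPath : (G : Graph) → DFSState G → Fin (n G) → Set
EscapingPath G s v =
  Σ (Fin (n G)) λ x → Σ (Fin (m G)) λ b →
    TreePath G s (MutuallyReachable G v) v x ×
    IsNonTreeArc s b × src G b ≡ x ×
    MutuallyReachable G v (tgt G b) ×
    pre s (tgt G b) < pre s v

{-# OPTIONS --safe #-}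
module Submission where

-- The exploration maintains an invariant in terms of tree descendants: every
-- vertex visited after an ancestor u of the current vertex is a descendant of
-- u, and a traversed non-tree arc from x to y with u.pre ≤ y.pre, for u an
-- ancestor of x, ends at a descendant of u.  Tree arcs increase pre, so
-- descendants of v have pre ≥ v.pre, and a leader is never left by an escaping
-- path.  Conversely, follow any path from v to a vertex w of its component: as
-- long as we are at a descendant of v, a tree arc leads to a descendant, and a
-- non-tree arc leads either to a vertex of pre < v.pre, which gives an escaping
-- path, or, by the invariant, to a descendant.  Without escaping paths w is
-- thus a descendant of v, so v.pre ≤ w.pre.

open import Defs
open import Data.Fin using (Fin; _≟_)
open import Data.Product using (_×_; _,_; ∃; proj₁; proj₂)
open import Data.Nat using (ℕ; suc; _<_; _≤_; z≤n; s≤s; _<?_)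
open import Data.Nat.Properties using (≤-refl; ≤-trans; <⇒≤; <⇒≱; ≮⇒≥)
open import Data.List using (List; []; _∷_; _∷ʳ_; length)
open import Data.List.Membership.Propositional using (_∈_; _∉_)
open import Data.List.Membership.Propositional.Properties using (∈-++⁺ˡ; ∈-++⁺ʳ; ∈-++⁻)
open import Data.List.Relation.Unary.Any using (here; there; any?)
open import Data.Maybe using (Maybe; just; nothing)
open import Data.Sum using (_⊎_; inj₁; inj₂)
open import Data.Empty using (⊥-elim)
open import Data.Unit using (⊤; tt)
open import Function using (_∘_)
open import Relation.Nullary using (¬_; yes; no)
open import Relation.Binary.PropositionalEquality using (_≡_; refl; sym; cong; subst; subst₂)
open import Relation.Binary.Construct.Closure.ReflexiveTransitive
  using (Star; ε; _◅_; _◅◅_; return)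
  renaming (map to Star-map)

module _ {A : Set} where

  ∈-∷ʳ⁻ : ∀ {xs : List A} {x z} → x ∈ xs ∷ʳ z → x ∈ xs ⊎ x ≡ z
  ∈-∷ʳ⁻ {xs} x∈ with ∈-++⁻ xs x∈
  ... | inj₁ x∈xs       = inj₁ x∈xs
  ... | inj₂ (here x≡z) = inj₂ x≡z

  ∈-∷ʳ-last : ∀ (xs : List A) {z} → z ∈ xs ∷ʳ z
  ∈-∷ʳ-last xs = ∈-++⁺ʳ xs (here refl)

module _ {k : ℕ} where

  position-∷ʳ : ∀ (xs : List (Fin k)) z {y} → y ∈ xs → position (xs ∷ʳ z) y ≡ position xs y
  position-∷ʳ (x ∷ xs) z {y} y∈ with x ≟ y | y∈
  ... | yes _  | _          = refl
  ... | no x≢y | here y≡x   = ⊥-elim (x≢y (sym y≡x))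
  ... | no _   | there y∈xs = cong suc (position-∷ʳ xs z y∈xs)

  position-∷ʳ-last : ∀ (xs : List (Fin k)) {z} → z ∉ xs → position (xs ∷ʳ z) z ≡ length xs
  position-∷ʳ-last [] {z} _ with z ≟ z
  ... | yes _  = refl
  ... | no z≢z = ⊥-elim (z≢z refl)
  position-∷ʳ-last (x ∷ xs) {z} z∉ with x ≟ z
  ... | yes x≡z = ⊥-elim (z∉ (here (sym x≡z)))
  ... | no _    = cong suc (position-∷ʳ-last xs (z∉ ∘ there))

  position<length : ∀ (xs : List (Fin k)) {y} → y ∈ xs → position xs y < length xs
  position<length (x ∷ xs) {y} y∈ with x ≟ y | y∈
  ... | yes _  | _          = s≤s z≤n
  ... | no x≢y | here y≡x   = ⊥-elim (x≢y (sym y≡x))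
  ... | no _   | there y∈xs = s≤s (position<length xs y∈xs)

  position-∷ʳ-last-maximal : ∀ (xs : List (Fin k)) {z y} → z ∉ xs → y ∈ xs ∷ʳ z →
    position (xs ∷ʳ z) z ≤ position (xs ∷ʳ z) y → y ≡ z
  position-∷ʳ-last-maximal xs z∉ y∈ z≤y with ∈-∷ʳ⁻ y∈
  ... | inj₂ y≡z  = y≡z
  ... | inj₁ y∈xs = ⊥-elim (<⇒≱ y<z z≤y)
    where
    y<z = subst₂ _<_ (sym (position-∷ʳ xs _ y∈xs)) (sym (position-∷ʳ-last xs z∉))
                     (position<length xs y∈xs)

module _ (G : Graph) where

  private
    Vertex : Set
    Vertex = Fin (n G)

    ArcId : Set
    ArcId = Fin (m G)

  TreeArc : List ArcId → Vertex → Vertex → Set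
  TreeArc ta u w = ∃ λ a → a ∈ ta × src G a ≡ u × tgt G a ≡ w

  Descendant : List ArcId → Vertex → Vertex → Set
  Descendant ta = Star (TreeArc ta)

  Within : List Vertex → List ArcId → Set
  Within vo as = ∀ {a} → a ∈ as → src G a ∈ vo × tgt G a ∈ vo

  Ascending : List Vertex → List ArcId → Set
  Ascending vo ta = ∀ {a} → a ∈ ta → position vo (src G a) < position vo (tgt G a)

  Covers : List Vertex → List ArcId → Vertex → Vertex → Set
  Covers vo ta x y = ∀ u → Descendant ta u x → position vo u ≤ position vo y → Descendant ta u y

  CurrentCovers : List Vertex → List ArcId → Maybe Vertex → Set
  CurrentCovers vo ta nothing  = ⊤
  CurrentCovers vo ta (just c) = c ∈ vo × (∀ {y} → y ∈ vo → Covers vo ta c y)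

  record Invariant (vo : List Vertex) (tr ta : List ArcId) (cur : Maybe Vertex) : Set where
    field
      tree-within      : Within vo ta
      traversed-within : Within vo tr
      tree-ascending   : Ascending vo ta
      nonTree-covers   : ∀ {b} → b ∈ tr → b ∉ ta → Covers vo ta (src G b) (tgt G b)
      current-covers   : CurrentCovers vo ta cur
  open Invariant

  Descendant-∷ʳ : ∀ {ta a u x} → Descendant ta u x → Descendant (ta ∷ʳ a) u x
  Descendant-∷ʳ = Star-map λ (b , b∈ , eqs) → b , ∈-++⁺ˡ b∈ , eqs

  Descendant⇒Reachable : ∀ {ta u x} → Descendant ta u x → Reachable G u x
  Descendant⇒Reachable = Star-map λ (a , _ , eqs) → a , eqs

  Descendant⇒position≤ : ∀ {vo ta u x} → Ascending vo ta → Descendant ta u x →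
    position vo u ≤ position vo x
  Descendant⇒position≤ asc ε = ≤-refl
  Descendant⇒position≤ {vo} asc ((b , b∈ , refl , refl) ◅ d) =
    ≤-trans (<⇒≤ (asc b∈)) (Descendant⇒position≤ {vo} asc d)

  ancestor-visited : ∀ {vo ta u x} → Within vo ta → Descendant ta u x → x ∈ vo → u ∈ vo
  ancestor-visited within ε x∈ = x∈
  ancestor-visited within ((b , b∈ , refl , _) ◅ _) _ = proj₁ (within b∈)

  ancestor-of-unvisited : ∀ {vo ta u x} → Within vo ta → Descendant ta u x → x ∉ vo → u ≡ x
  ancestor-of-unvisited within ε x∉ = refl
  ancestor-of-unvisited within ((b , b∈ , _ , refl) ◅ d) x∉
    with ancestor-of-unvisited within d x∉
  ... | refl = ⊥-elim (x∉ (proj₂ (within b∈)))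

  Descendant-∷ʳ⁻ : ∀ {vo ta a u x} → Within vo ta → tgt G a ∉ vo →
    Descendant (ta ∷ʳ a) u x → x ∈ vo → Descendant ta u x
  Descendant-∷ʳ⁻ within z∉ ε x∈ = ε
  Descendant-∷ʳ⁻ within z∉ ((b , b∈ , u≡ , refl) ◅ d) x∈
    with Descendant-∷ʳ⁻ within z∉ d x∈ | ∈-∷ʳ⁻ b∈
  ... | d′ | inj₁ b∈ta = (b , b∈ta , u≡ , refl) ◅ d′
  ... | d′ | inj₂ refl = ⊥-elim (z∉ (ancestor-visited within d′ x∈))

  Descendant-∷ʳ-last : ∀ {vo ta a u} → Within vo ta → tgt G a ∉ vo → src G a ∈ vo →
    Descendant (ta ∷ʳ a) u (tgt G a) → u ≡ tgt G a ⊎ Descendant ta u (src G a)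
  Descendant-∷ʳ-last within z∉ c∈ ε = inj₁ refl
  Descendant-∷ʳ-last {vo} within z∉ c∈ ((b , b∈ , refl , refl) ◅ d)
    with Descendant-∷ʳ-last within z∉ c∈ d | ∈-∷ʳ⁻ b∈
  ... | inj₁ b↦z   | inj₁ b∈ta = ⊥-elim (z∉ (subst (_∈ vo) b↦z (proj₂ (within b∈ta))))
  ... | inj₁ _     | inj₂ refl = inj₂ ε
  ... | inj₂ d′    | inj₁ b∈ta = inj₂ ((b , b∈ta , refl , refl) ◅ d′)
  ... | inj₂ d′    | inj₂ refl = ⊥-elim (z∉ (ancestor-visited within d′ c∈))

  Within-∷ʳ : ∀ {vo as z} → Within vo as → Within (vo ∷ʳ z) as
  Within-∷ʳ within a∈ = ∈-++⁺ˡ (proj₁ (within a∈)) , ∈-++⁺ˡ (proj₂ (within a∈))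

  Ascending-∷ʳ : ∀ {vo ta z} → Within vo ta → Ascending vo ta → Ascending (vo ∷ʳ z) ta
  Ascending-∷ʳ {vo} {z = z} within asc a∈ =
    subst₂ _<_ (sym (position-∷ʳ vo z (proj₁ (within a∈))))
               (sym (position-∷ʳ vo z (proj₂ (within a∈)))) (asc a∈)

  Covers-∷ʳ : ∀ {vo ta z x y} → Within vo ta → x ∈ vo → y ∈ vo →
    Covers vo ta x y → Covers (vo ∷ʳ z) ta x y
  Covers-∷ʳ {vo} {z = z} within x∈ y∈ covers u d u≤y =
    covers u d (subst₂ _≤_ (position-∷ʳ vo z (ancestor-visited within d x∈))
                           (position-∷ʳ vo z y∈) u≤y)

  Covers-treeArc : ∀ {vo vo′ ta a x y} → Within vo ta → tgt G a ∉ vo → x ∈ vo →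
    Covers vo′ ta x y → Covers vo′ (ta ∷ʳ a) x y
  Covers-treeArc within z∉ x∈ covers u d u≤y =
    Descendant-∷ʳ (covers u (Descendant-∷ʳ⁻ within z∉ d x∈) u≤y)

  Covers-parent : ∀ {vo ta a y} → a ∈ ta → Covers vo ta (tgt G a) y → Covers vo ta (src G a) y
  Covers-parent a∈ covers u d = covers u (d ◅◅ return (_ , a∈ , refl , refl))

  Within-treeArc : ∀ {vo as a} → Within vo as → src G a ∈ vo → Within (vo ∷ʳ tgt G a) (as ∷ʳ a)
  Within-treeArc {vo} within c∈ b∈ with ∈-∷ʳ⁻ b∈
  ... | inj₁ b∈as = Within-∷ʳ within b∈as
  ... | inj₂ refl = ∈-++⁺ˡ c∈ , ∈-∷ʳ-last vo

  Ascending-treeArc : ∀ {vo ta a} → Within vo ta → Ascending vo ta → src G a ∈ vo →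
    tgt G a ∉ vo → Ascending (vo ∷ʳ tgt G a) (ta ∷ʳ a)
  Ascending-treeArc {vo} within asc c∈ z∉ b∈ with ∈-∷ʳ⁻ b∈
  ... | inj₁ b∈ta = Ascending-∷ʳ within asc b∈ta
  ... | inj₂ refl = subst₂ _<_ (sym (position-∷ʳ vo _ c∈)) (sym (position-∷ʳ-last vo z∉))
                               (position<length vo c∈)

  newRoot-preserves : ∀ {vo tr ta v} → v ∉ vo → Invariant vo tr ta nothing →
    Invariant (vo ∷ʳ v) tr ta (just v)
  newRoot-preserves {vo} {tr} {ta} {v} v∉ inv = record
    { tree-within      = Within-∷ʳ (tree-within inv)
    ; traversed-within = Within-∷ʳ (traversed-within inv)
    ; tree-ascending   = Ascending-∷ʳ (tree-within inv) (tree-ascending inv)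
    ; nonTree-covers   = λ b∈ b∉ → Covers-∷ʳ (tree-within inv) (proj₁ (traversed-within inv b∈))
                                     (proj₂ (traversed-within inv b∈)) (nonTree-covers inv b∈ b∉)
    ; current-covers   = ∈-∷ʳ-last vo , root-covers
    }
    where
    root-covers : ∀ {y} → y ∈ vo ∷ʳ v → Covers (vo ∷ʳ v) ta v y
    root-covers y∈ u d v≤y with ancestor-of-unvisited (tree-within inv) d v∉
    ... | refl with position-∷ʳ-last-maximal vo v∉ y∈ v≤y
    ...   | refl = ε

  nonTreeArc-preserves : ∀ {vo tr ta c a} → src G a ≡ c → tgt G a ∈ vo →
    Invariant vo tr ta (just c) → Invariant vo (tr ∷ʳ a) ta (just c)
  nonTreeArc-preserves {vo} {tr} {ta} {a = a} refl t∈ inv = record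
    { tree-within      = tree-within inv
    ; traversed-within = traversed-within′
    ; tree-ascending   = tree-ascending inv
    ; nonTree-covers   = nonTree-covers′
    ; current-covers   = current-covers inv
    }
    where
    traversed-within′ : Within vo (tr ∷ʳ a)
    traversed-within′ b∈ with ∈-∷ʳ⁻ b∈
    ... | inj₁ b∈tr = traversed-within inv b∈tr
    ... | inj₂ refl = proj₁ (current-covers inv) , t∈
    nonTree-covers′ : ∀ {b} → b ∈ tr ∷ʳ a → b ∉ ta → Covers vo ta (src G b) (tgt G b)
    nonTree-covers′ b∈ b∉ with ∈-∷ʳ⁻ b∈
    ... | inj₁ b∈tr = nonTree-covers inv b∈tr b∉
    ... | inj₂ refl = proj₂ (current-covers inv) t∈

  treeArc-preserves : ∀ {vo tr ta c a} → src G a ≡ c → tgt G a ∉ vo →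
    Invariant vo tr ta (just c) → Invariant (vo ∷ʳ tgt G a) (tr ∷ʳ a) (ta ∷ʳ a) (just (tgt G a))
  treeArc-preserves {vo} {tr} {ta} {a = a} refl z∉ inv = record
    { tree-within      = Within-treeArc (tree-within inv) c∈
    ; traversed-within = Within-treeArc (traversed-within inv) c∈
    ; tree-ascending   = Ascending-treeArc (tree-within inv) (tree-ascending inv) c∈ z∉
    ; nonTree-covers   = nonTree-covers′
    ; current-covers   = ∈-∷ʳ-last vo , child-covers
    }
    where
    z = tgt G a
    c∈ = proj₁ (current-covers inv)
    lift : ∀ {x y} → x ∈ vo → y ∈ vo → Covers vo ta x y → Covers (vo ∷ʳ z) (ta ∷ʳ a) x y
    lift x∈ y∈ = Covers-treeArc {vo′ = vo ∷ʳ z} (tree-within inv) z∉ x∈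
               ∘ Covers-∷ʳ (tree-within inv) x∈ y∈
    nonTree-covers′ : ∀ {b} → b ∈ tr ∷ʳ a → b ∉ ta ∷ʳ a →
      Covers (vo ∷ʳ z) (ta ∷ʳ a) (src G b) (tgt G b)
    nonTree-covers′ b∈ b∉ with ∈-∷ʳ⁻ b∈
    ... | inj₂ refl = ⊥-elim (b∉ (∈-∷ʳ-last ta))
    ... | inj₁ b∈tr = lift (proj₁ (traversed-within inv b∈tr)) (proj₂ (traversed-within inv b∈tr))
                           (nonTree-covers inv b∈tr (b∉ ∘ ∈-++⁺ˡ))
    child-covers : ∀ {y} → y ∈ vo ∷ʳ z → Covers (vo ∷ʳ z) (ta ∷ʳ a) z y
    child-covers y∈ u d z≤y with Descendant-∷ʳ-last (tree-within inv) z∉ c∈ d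
    ... | inj₁ refl with position-∷ʳ-last-maximal vo z∉ y∈ z≤y
    ...   | refl = ε
    child-covers y∈ u d u≤y | inj₂ d′ with ∈-∷ʳ⁻ y∈
    ...   | inj₂ refl = Descendant-∷ʳ d′ ◅◅ return (a , ∈-∷ʳ-last ta , refl , refl)
    ...   | inj₁ y∈vo = lift c∈ y∈vo (proj₂ (current-covers inv) y∈vo) u (Descendant-∷ʳ d′) u≤y

  InvariantAt : DFSState G → Set
  InvariantAt s = Invariant (visitOrder s) (traversed s) (treeArcs s) (current s)

  step-preserves : ∀ {s s′} → Step G s s′ → InvariantAt s → InvariantAt s′
  step-preserves (newRoot _ v∉)          = newRoot-preserves v∉
  step-preserves (nonTreeArc _ a↦ _ t∈) = nonTreeArc-preserves a↦ t∈
  step-preserves (treeArc _ a↦ _ z∉)    = treeArc-preserves a↦ z∉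
  step-preserves (finishRoot _ _) inv    = record
    { tree-within = tree-within inv ; traversed-within = traversed-within inv
    ; tree-ascending = tree-ascending inv ; nonTree-covers = nonTree-covers inv
    ; current-covers = tt }
  step-preserves {mkState vo _ _ _ _} (retreat a _ _ a∈ refl) inv = record
    { tree-within = tree-within inv ; traversed-within = traversed-within inv
    ; tree-ascending = tree-ascending inv ; nonTree-covers = nonTree-covers inv
    ; current-covers = proj₁ (tree-within inv a∈)
                     , λ y∈ → Covers-parent {vo} a∈ (proj₂ (current-covers inv) y∈) }

  exploration-invariant : ∀ {s} → Star (Step G) (initial G) s → InvariantAt s
  exploration-invariant = go initial-invariant
    where
    initial-invariant : InvariantAt (initial G)
    initial-invariant = record
      { tree-within = λ () ; traversed-within = λ () ; tree-ascending = λ ()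
      ; nonTree-covers = λ () ; current-covers = tt }
    go : ∀ {s s′} → InvariantAt s → Star (Step G) s s′ → InvariantAt s′
    go inv ε          = inv
    go inv (st ◅ run) = go (step-preserves st inv) run

  Descendant⇒TreePath : ∀ {s v u x} → Reachable G v u → Descendant (treeArcs s) u x →
    Reachable G x v → TreePath G s (MutuallyReachable G v) u x
  Descendant⇒TreePath v↝u ε x↝v = empty (v↝u , x↝v)
  Descendant⇒TreePath v↝u ((a , a∈ , refl , refl) ◅ d) x↝v =
    cons a a∈ refl (v↝u , (a , refl , refl) ◅ (Descendant⇒Reachable d ◅◅ x↝v))
      (Descendant⇒TreePath (v↝u ◅◅ return (a , refl , refl)) d x↝v)

  IsLeader⇒¬EscapingPath : ∀ {s v} → IsLeader G s v → ¬ EscapingPath G s v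
  IsLeader⇒¬EscapingPath leader (_ , b , _ , _ , _ , v~w , w<v) = <⇒≱ w<v (leader (tgt G b) v~w)

  module _ {s : DFSState G} (inv : InvariantAt s) (all-traversed : ∀ a → a ∈ traversed s)
           {v : Vertex} (no-escape : ¬ EscapingPath G s v) where

    component-descends : ∀ {x w} → Descendant (treeArcs s) v x → Reachable G x w →
      Reachable G w v → Descendant (treeArcs s) v w
    component-descends d ε w↝v = d
    component-descends d ((a , refl , refl) ◅ r) w↝v with any? (a ≟_) (treeArcs s)
    ... | yes a∈ = component-descends (d ◅◅ return (a , a∈ , refl , refl)) r w↝v
    ... | no a∉ with pre s (tgt G a) <? pre s v
    ...   | yes t<v = ⊥-elim (no-escape escaping)
      where
      t↝v = r ◅◅ w↝v
      escaping : EscapingPath G s v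
      escaping = src G a , a , Descendant⇒TreePath ε d ((a , refl , refl) ◅ t↝v)
               , (all-traversed a , a∉) , refl
               , (Descendant⇒Reachable d ◅◅ return (a , refl , refl) , t↝v) , t<v
    ...   | no t≮v = component-descends
                       (nonTree-covers inv (all-traversed a) a∉ v d (≮⇒≥ t≮v)) r w↝v

    ¬EscapingPath⇒IsLeader : IsLeader G s v
    ¬EscapingPath⇒IsLeader w (v↝w , w↝v) =
      Descendant⇒position≤ {visitOrder s} (tree-ascending inv) (component-descends ε v↝w w↝v)

lemma11 : (G : Graph) (s : DFSState G) → DepthFirstExploration G s →
    (v : Fin (n G)) →
    (IsLeader G s v → ¬ EscapingPath G s v) × (¬ EscapingPath G s v → IsLeader G s v)
lemma11 G s (run , _ , all-traversed) v =
  IsLeader⇒¬EscapingPath G , ¬EscapingPath⇒IsLeader G (exploration-invariant G run) all-traversed
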